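{- Let $G$ be a connected bidegreed graph with $n$ vertices, $m$ edges and degrees $\Delta>\delta$. Then $S(G)=IRD(G)\le IRR(G)$, with equality if and only if $G$ is balanced, i.e. $n\ge 4$ is even and $N_\Delta=N_\delta=n/2$.
   Context: A bidegreed graph is a graph whose vertices have exactly two distinct degrees $\Delta>\delta$; $N_\Delta,N_\delta$ denote the numbers of vertices of degree $\Delta,\delta$. With degrees $d_1,\dots,d_n$: $S(G)=\sum_i|d_i-\frac{2m}{n}|$, $IRR(G)=\frac n2(\Delta-\delta)$, $IRD(G)=\frac{2N_\Delta N_\delta}{N_\delta+N_\Delta}(\Delta-\delta)$. -}

module Defs where

open import Data.Bool using (Bool; true; false; if_then_else_)
open import Data.Nat as ℕ using (ℕ; zero; suc; _+_; _*_; _∸_; _<_)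
open import Data.Fin using (Fin; toℕ)
open import Data.List using (List; map; allFin)
open import Data.Nat.ListAction using (sum)
open import Data.Integer using (+_)
open import Data.Rational as ℚ using (ℚ; 0ℚ)
open import Relation.Binary.PropositionalEquality using (_≡_)
open import Relation.Nullary using (Dec; yes; no)

record Graph (n : ℕ) : Set where
  field
    adj    : Fin n → Fin n → Bool
    sym    : ∀ i j → adj i j ≡ adj j i
    irrefl : ∀ i → adj i i ≡ false
open Graph public

deg : ∀ {n} → Graph n → Fin n → ℕ
deg {n} G i = sum (map (λ j → if adj G i j then 1 else 0) (allFin n))

edges : ∀ {n} → Graph n → ℕ
edges {n} G = sum (map (λ i → sum (map (λ j →
  if adj G i j then (if toℕ i ℕ.<ᵇ toℕ j then 1 else 0) else 0) (allFin n))) (allFin n))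

data Walk {n} (G : Graph n) : Fin n → Fin n → Set where
  [] : ∀ {i} → Walk G i i
  _∷_ : ∀ {i j k} → adj G i j ≡ true → Walk G j k → Walk G i k

Connected : ∀ {n} → Graph n → Set
Connected {n} G = ∀ (i j : Fin n) → Walk G i j

countDeg : ∀ {n} → Graph n → ℕ → ℕ
countDeg {n} G d = sum (map (λ i → if deg G i ℕ.≡ᵇ d then 1 else 0) (allFin n))

Bidegreed : ∀ {n} → Graph n → ℕ → ℕ → Set
Bidegreed {n} G Δ δ =
  (δ < Δ) × (∀ i → (deg G i ≡ Δ) ⊎ (deg G i ≡ δ))
  × (Σ (Fin n) λ i → deg G i ≡ Δ) × (Σ (Fin n) λ i → deg G i ≡ δ)
  where open import Data.Product using (_×_; Σ)
        open import Data.Sum using (_⊎_)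

-- a / b as a rational (b = 0 never occurs in use; returns 0 then)
_÷ℕ_ : ℕ → ℕ → ℚ
a ÷ℕ zero = 0ℚ
a ÷ℕ suc b = (+ a) ℚ./ suc b

fromℕ : ℕ → ℚ
fromℕ a = (+ a) ℚ./ 1

S : ∀ {n} → Graph n → ℚ
S {n} G = Data.List.foldr ℚ._+_ 0ℚ
  (map (λ i → ℚ.∣ fromℕ (deg G i) ℚ.- ((2 * edges G) ÷ℕ n) ∣) (allFin n))
  where import Data.List

IRR : ∀ {n} → Graph n → ℕ → ℕ → ℚ
IRR {n} G Δ δ = (n * (Δ ∸ δ)) ÷ℕ 2

IRD : ∀ {n} → Graph n → ℕ → ℕ → ℚ
IRD G Δ δ = (2 * countDeg G Δ * countDeg G δ * (Δ ∸ δ)) ÷ℕ (countDeg G δ + countDeg G Δ)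

-- Write a = N_Δ, b = N_δ and D = Δ − δ. Counting vertices by degree gives
-- a + b = n, and the handshake lemma gives 2m = aΔ + bδ; hence
-- Δ − 2m/n = bD/n and 2m/n − δ = aD/n, so S(G) = (a·bD + b·aD)/n = IRD(G).
-- Clearing denominators, IRD(G) ≤ IRR(G) is 4ab ≤ (a + b)², which holds
-- because (a + b)² = 4ab + (a − b)², with equality exactly when a = b.
-- Finally a = b = 1 cannot occur: a connected graph on two vertices is
-- regular.
module Submission where

open import Defs hiding (sym)
open import Data.Bool using (Bool; true; false; if_then_else_)
open import Data.Fin using (Fin; toℕ; zero; suc)
open import Data.Fin.Properties using (toℕ-injective)
open import Data.Integer as ℤ using (_⊖_)
import Data.Integer.Properties as ℤ
open import Data.Integer.Tactic.RingSolver using () renaming (solve-∀ to solve-∀ℤ)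
open import Data.List using (List; []; _∷_; map; foldr; allFin; length)
open import Data.List.Properties using (length-tabulate; map-cong)
open import Data.List.Membership.Propositional using (_∈_)
open import Data.List.Membership.Propositional.Properties using (∈-allFin)
open import Data.List.Relation.Unary.Any using (here; there)
open import Data.Nat as ℕ
  using (ℕ; zero; suc; _+_; _*_; _∸_; _<_; _≤_; z≤n; s≤s; ∣_-_∣; NonZero; >-nonZero)
open import Data.Nat.Divisibility using (_∣_; divides)
open import Data.Nat.ListAction using (sum)
open import Data.Nat.Properties
open import Data.Nat.Tactic.RingSolver using (solve-∀)
open import Data.Product using (_×_; _,_)
open import Data.Rational as ℚ using (ℚ; 0ℚ; toℚᵘ)
import Data.Rational.Properties as ℚ
open import Data.Rational.Unnormalised as ℚᵘ using (mkℚᵘ; _≃_; *≡*; *≤*)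
import Data.Rational.Unnormalised.Properties as ℚᵘ
open import Data.Sum using (_⊎_; inj₁; inj₂; [_,_]′)
open import Function.Base using (_∘_; id)
open import Function.Bundles using (_⇔_; mk⇔; Equivalence)
open import Function.Properties.Equivalence using () renaming (trans to ⇔-trans)
open import Relation.Binary.Definitions using (tri<; tri≈; tri>)
open import Relation.Binary.PropositionalEquality
open import Relation.Nullary using (¬_; contradiction)
open import Relation.Nullary.Reflects using (Reflects; ofʸ; ofⁿ; fromEquivalence)

𝟙 : Bool → ℕ
𝟙 b = if b then 1 else 0

𝟙≤1 : ∀ b → 𝟙 b ≤ 1
𝟙≤1 true  = s≤s z≤n
𝟙≤1 false = z≤n

module _ {p} {P : Set p} where

  𝟙-true : ∀ {b} → Reflects P b → P → 𝟙 b ≡ 1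
  𝟙-true (ofʸ _)  _ = refl
  𝟙-true (ofⁿ ¬p) p = contradiction p ¬p

  𝟙-false : ∀ {b} → Reflects P b → ¬ P → 𝟙 b ≡ 0
  𝟙-false (ofʸ p) ¬p = contradiction p ¬p
  𝟙-false (ofⁿ _) _  = refl

≡ᵇ-reflects-≡ : ∀ m n → Reflects (m ≡ n) (m ℕ.≡ᵇ n)
≡ᵇ-reflects-≡ m n = fromEquivalence (≡ᵇ⇒≡ m n) (≡⇒≡ᵇ m n)

𝟙[m<n]+𝟙[n<m]≡1 : ∀ {m n} → m ≢ n → 𝟙 (m ℕ.<ᵇ n) + 𝟙 (n ℕ.<ᵇ m) ≡ 1
𝟙[m<n]+𝟙[n<m]≡1 {m} {n} m≢n with <-cmp m n
... | tri< m<n _ n≮m = cong₂ _+_ (𝟙-true (<ᵇ-reflects-< m n) m<n) (𝟙-false (<ᵇ-reflects-< n m) n≮m)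
... | tri≈ _ m≡n _   = contradiction m≡n m≢n
... | tri> m≮n _ n<m = cong₂ _+_ (𝟙-false (<ᵇ-reflects-< m n) m≮n) (𝟙-true (<ᵇ-reflects-< n m) n<m)

module _ {A : Set} where

  sum-map-+ : ∀ (f g : A → ℕ) xs →
    sum (map (λ x → f x + g x) xs) ≡ sum (map f xs) + sum (map g xs)
  sum-map-+ f g []       = refl
  sum-map-+ f g (x ∷ xs) = begin
    f x + g x + sum (map (λ x → f x + g x) xs)     ≡⟨ cong (f x + g x +_) (sum-map-+ f g xs) ⟩
    f x + g x + (sum (map f xs) + sum (map g xs))  ≡⟨ +-exchange (f x) (g x) _ _ ⟩
    f x + sum (map f xs) + (g x + sum (map g xs))  ∎
    where
    open ≡-Reasoning
    +-exchange : ∀ a b c d → a + b + (c + d) ≡ a + c + (b + d)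
    +-exchange = solve-∀

  sum-map-*ʳ : ∀ (f : A → ℕ) c xs → sum (map (λ x → f x * c) xs) ≡ sum (map f xs) * c
  sum-map-*ʳ f c []       = refl
  sum-map-*ʳ f c (x ∷ xs) =
    trans (cong (f x * c +_) (sum-map-*ʳ f c xs)) (sym (*-distribʳ-+ c (f x) (sum (map f xs))))

  sum-map-const-0 : ∀ (xs : List A) → sum (map (λ _ → 0) xs) ≡ 0
  sum-map-const-0 []       = refl
  sum-map-const-0 (x ∷ xs) = sum-map-const-0 xs

  sum-map-const-1 : ∀ (xs : List A) → sum (map (λ _ → 1) xs) ≡ length xs
  sum-map-const-1 []       = refl
  sum-map-const-1 (x ∷ xs) = cong suc (sum-map-const-1 xs)

  ∈⇒≤sum-map : ∀ (f : A → ℕ) {x xs} → x ∈ xs → f x ≤ sum (map f xs)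
  ∈⇒≤sum-map f {xs = y ∷ xs} (here refl) = m≤m+n (f y) _
  ∈⇒≤sum-map f {xs = y ∷ xs} (there x∈xs) = ≤-trans (∈⇒≤sum-map f x∈xs) (m≤n+m _ (f y))

sum-map-swap : ∀ {A B : Set} (f : A → B → ℕ) xs ys →
  sum (map (λ x → sum (map (f x) ys)) xs) ≡ sum (map (λ y → sum (map (λ x → f x y) xs)) ys)
sum-map-swap f []       ys = sym (sum-map-const-0 ys)
sum-map-swap f (x ∷ xs) ys =
  trans (cong (sum (map (f x) ys) +_) (sum-map-swap f xs ys))
        (sym (sum-map-+ (f x) (λ y → sum (map (λ x → f x y) xs)) ys))

module _ {n} (G : Graph n) where

  private
    forward : Fin n → Fin n → ℕ
    forward i j = if adj G i j then 𝟙 (toℕ i ℕ.<ᵇ toℕ j) else 0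

  𝟙-adj≡forward+backward : ∀ i j → 𝟙 (adj G i j) ≡ forward i j + forward j i
  𝟙-adj≡forward+backward i j rewrite Graph.sym G j i with adj G i j in e
  ... | true  = sym (𝟙[m<n]+𝟙[n<m]≡1 (i≢j ∘ toℕ-injective))
    where
    i≢j : i ≢ j
    i≢j refl = contradiction (trans (sym e) (irrefl G i)) λ ()
  ... | false = refl

  handshake : 2 * edges G ≡ sum (map (deg G) (allFin n))
  handshake = sym (begin
    sum (map (λ i → sum (map (λ j → 𝟙 (adj G i j)) vs)) vs)
      ≡⟨ cong sum (map-cong (λ i → cong sum (map-cong (𝟙-adj≡forward+backward i) vs)) vs) ⟩
    sum (map (λ i → sum (map (λ j → forward i j + forward j i) vs)) vs)
      ≡⟨ cong sum (map-cong (λ i → sum-map-+ (forward i) (λ j → forward j i) vs) vs) ⟩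
    sum (map (λ i → sum (map (forward i) vs) + sum (map (λ j → forward j i) vs)) vs)
      ≡⟨ sum-map-+ _ _ vs ⟩
    edges G + sum (map (λ i → sum (map (λ j → forward j i) vs)) vs)
      ≡⟨ cong (edges G +_) (sym (sum-map-swap forward vs vs)) ⟩
    edges G + edges G
      ≡⟨ cong (edges G +_) (sym (+-identityʳ (edges G))) ⟩
    2 * edges G ∎)
    where
    open ≡-Reasoning
    vs = allFin n

  adj⇒1≤deg : ∀ {i j} → adj G i j ≡ true → 1 ≤ deg G i
  adj⇒1≤deg {i} {j} e =
    subst (_≤ deg G i) (cong 𝟙 e) (∈⇒≤sum-map (λ j → 𝟙 (adj G i j)) (∈-allFin j))

  connected⇒1≤deg : Connected G → ∀ {i j} → i ≢ j → 1 ≤ deg G i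
  connected⇒1≤deg conn {i} {j} i≢j with conn i j
  ... | []    = contradiction refl i≢j
  ... | e ∷ _ = adj⇒1≤deg e

two-vertex-deg≤1 : (G : Graph 2) → ∀ i → deg G i ≤ 1
two-vertex-deg≤1 G zero rewrite irrefl G zero =
  subst (_≤ 1) (sym (+-identityʳ _)) (𝟙≤1 (adj G zero (suc zero)))
two-vertex-deg≤1 G (suc zero) rewrite irrefl G (suc zero) =
  subst (_≤ 1) (sym (+-identityʳ _)) (𝟙≤1 (adj G (suc zero) zero))

two-vertex-connected⇒1≤deg : (G : Graph 2) → Connected G → ∀ i → 1 ≤ deg G i
two-vertex-connected⇒1≤deg G conn zero       = connected⇒1≤deg G conn {j = suc zero} λ ()
two-vertex-connected⇒1≤deg G conn (suc zero) = connected⇒1≤deg G conn {j = zero} λ ()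

connected-bidegreed⇒3≤n : ∀ {n Δ δ} (G : Graph n) → Connected G → Bidegreed G Δ δ → 3 ≤ n
connected-bidegreed⇒3≤n {0} G conn (_ , _ , (() , _) , _)
connected-bidegreed⇒3≤n {1} G conn (δ<Δ , _ , (zero , dΔ) , (zero , dδ)) =
  contradiction (trans (sym dδ) dΔ) (<⇒≢ δ<Δ)
connected-bidegreed⇒3≤n {2} G conn (δ<Δ , _ , (iΔ , dΔ) , (iδ , dδ)) =
  contradiction (≤-trans δ<Δ (≤-trans Δ≤1 1≤δ)) (n≮n _)
  where
  Δ≤1 = subst (_≤ 1) dΔ (two-vertex-deg≤1 G iΔ)
  1≤δ = subst (1 ≤_) dδ (two-vertex-connected⇒1≤deg G conn iδ)
connected-bidegreed⇒3≤n {suc (suc (suc n))} G conn _ = s≤s (s≤s (s≤s z≤n))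

module DegreeCount {n} (G : Graph n) {Δ δ} (δ<Δ : δ < Δ)
                   (deg-cases : ∀ i → deg G i ≡ Δ ⊎ deg G i ≡ δ) where

  private
    byDegree : ℕ → ℕ → Fin n → ℕ
    byDegree x y i = 𝟙 (deg G i ℕ.≡ᵇ Δ) * x + 𝟙 (deg G i ℕ.≡ᵇ δ) * y

    byDegree-Δ : ∀ {x y i} → deg G i ≡ Δ → byDegree x y i ≡ x
    byDegree-Δ {x} {y} {i} d
      rewrite 𝟙-true (≡ᵇ-reflects-≡ (deg G i) Δ) d
            | 𝟙-false (≡ᵇ-reflects-≡ (deg G i) δ) (λ d′ → <⇒≢ δ<Δ (trans (sym d′) d))
            = trans (+-identityʳ _) (+-identityʳ x)

    byDegree-δ : ∀ {x y i} → deg G i ≡ δ → byDegree x y i ≡ y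
    byDegree-δ {x} {y} {i} d
      rewrite 𝟙-false (≡ᵇ-reflects-≡ (deg G i) Δ) (λ d′ → <⇒≢ δ<Δ (trans (sym d) d′))
            | 𝟙-true (≡ᵇ-reflects-≡ (deg G i) δ) d
            = +-identityʳ y

  sum-map-by-degree : ∀ (f : Fin n → ℕ) {x y} →
    (∀ i → deg G i ≡ Δ → f i ≡ x) → (∀ i → deg G i ≡ δ → f i ≡ y) →
    sum (map f (allFin n)) ≡ countDeg G Δ * x + countDeg G δ * y
  sum-map-by-degree f {x} {y} fΔ fδ = begin
    sum (map f vs)
      ≡⟨ cong sum (map-cong f≗byDegree vs) ⟩
    sum (map (byDegree x y) vs)
      ≡⟨ sum-map-+ _ _ vs ⟩
    sum (map (λ i → 𝟙 (deg G i ℕ.≡ᵇ Δ) * x) vs) + sum (map (λ i → 𝟙 (deg G i ℕ.≡ᵇ δ) * y) vs)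
      ≡⟨ cong₂ _+_ (sum-map-*ʳ _ x vs) (sum-map-*ʳ _ y vs) ⟩
    countDeg G Δ * x + countDeg G δ * y ∎
    where
    open ≡-Reasoning
    vs = allFin n
    f≗byDegree : ∀ i → f i ≡ byDegree x y i
    f≗byDegree i with deg-cases i
    ... | inj₁ d = trans (fΔ i d) (sym (byDegree-Δ d))
    ... | inj₂ d = trans (fδ i d) (sym (byDegree-δ d))

  N_Δ+N_δ≡n : countDeg G Δ + countDeg G δ ≡ n
  N_Δ+N_δ≡n = begin
    countDeg G Δ + countDeg G δ          ≡⟨ cong₂ _+_ (*-identityʳ (countDeg G Δ)) (*-identityʳ (countDeg G δ)) ⟨
    countDeg G Δ * 1 + countDeg G δ * 1  ≡⟨ sum-map-by-degree (λ _ → 1) (λ _ _ → refl) (λ _ _ → refl) ⟨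
    sum (map (λ _ → 1) (allFin n))       ≡⟨ sum-map-const-1 (allFin n) ⟩
    length (allFin n)                    ≡⟨ length-tabulate _ ⟩
    n                                    ∎
    where open ≡-Reasoning

  2m≡N_ΔΔ+N_δδ : 2 * edges G ≡ countDeg G Δ * Δ + countDeg G δ * δ
  2m≡N_ΔΔ+N_δδ = trans (handshake G) (sum-map-by-degree (deg G) (λ _ d → d) (λ _ d → d))

private
  [m+n]²≡4mn+∣m-n∣²-≤ : ∀ {m n} → m ≤ n → (m + n) * (m + n) ≡ 4 * (m * n) + ∣ m - n ∣ * ∣ m - n ∣
  [m+n]²≡4mn+∣m-n∣²-≤ {m} {n} m≤n =
    subst (λ n → (m + n) * (m + n) ≡ 4 * (m * n) + ∣ m - n ∣ * ∣ m - n ∣)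
          (m+[n∸m]≡n m≤n) (identity (n ∸ m))
    where
    square : ∀ m t → (m + (m + t)) * (m + (m + t)) ≡ 4 * (m * (m + t)) + t * t
    square = solve-∀
    identity : ∀ t → (m + (m + t)) * (m + (m + t)) ≡ 4 * (m * (m + t)) + ∣ m - m + t ∣ * ∣ m - m + t ∣
    identity t rewrite ∣m-m+n∣≡n m t = square m t

[m+n]²≡4mn+∣m-n∣² : ∀ m n → (m + n) * (m + n) ≡ 4 * (m * n) + ∣ m - n ∣ * ∣ m - n ∣
[m+n]²≡4mn+∣m-n∣² m n with ≤-total m n
... | inj₁ m≤n = [m+n]²≡4mn+∣m-n∣²-≤ m≤n
... | inj₂ n≤m = begin
  (m + n) * (m + n)                        ≡⟨ cong₂ _*_ (+-comm m n) (+-comm m n) ⟩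
  (n + m) * (n + m)                        ≡⟨ [m+n]²≡4mn+∣m-n∣²-≤ n≤m ⟩
  4 * (n * m) + ∣ n - m ∣ * ∣ n - m ∣      ≡⟨ cong₂ (λ x d → 4 * x + d * d) (*-comm n m) (∣-∣-comm n m) ⟩
  4 * (m * n) + ∣ m - n ∣ * ∣ m - n ∣      ∎
  where open ≡-Reasoning

4mn≤[m+n]² : ∀ m n → 4 * (m * n) ≤ (m + n) * (m + n)
4mn≤[m+n]² m n = ≤-trans (m≤m+n _ _) (≤-reflexive (sym ([m+n]²≡4mn+∣m-n∣² m n)))

4mn≡[m+n]²⇔m≡n : ∀ {m n} → 4 * (m * n) ≡ (m + n) * (m + n) ⇔ m ≡ n
4mn≡[m+n]²⇔m≡n {m} {n} = mk⇔ to λ { refl → square m }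
  where
  square : ∀ m → 4 * (m * m) ≡ (m + m) * (m + m)
  square = solve-∀
  to : 4 * (m * n) ≡ (m + n) * (m + n) → m ≡ n
  to eq = ∣m-n∣≡0⇒m≡n ([ id , id ]′ (m*n≡0⇒m≡0∨n≡0 _ d²≡0))
    where
    d²≡0 : ∣ m - n ∣ * ∣ m - n ∣ ≡ 0
    d²≡0 = +-cancelˡ-≡ (4 * (m * n)) _ 0
      (trans (sym ([m+n]²≡4mn+∣m-n∣² m n)) (trans (sym eq) (sym (+-identityʳ _))))

3≤2m⇒4≤2m : ∀ m → 3 ≤ 2 * m → 4 ≤ 2 * m
3≤2m⇒4≤2m (suc zero) (s≤s (s≤s ()))
3≤2m⇒4≤2m (suc (suc m)) _ = *-monoʳ-≤ 2 (s≤s (s≤s z≤n))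

mkℚᵘ-≃⇔ : ∀ {p q k l} → mkℚᵘ (ℤ.+ p) k ≃ mkℚᵘ (ℤ.+ q) l ⇔ p * suc l ≡ q * suc k
mkℚᵘ-≃⇔ {p} {q} {k} {l} = mk⇔
  (λ { (*≡* eq) → ℤ.+-injective (trans (ℤ.pos-* p (suc l)) (trans eq (sym (ℤ.pos-* q (suc k))))) })
  (λ eq → *≡* (trans (sym (ℤ.pos-* p (suc l))) (trans (cong ℤ.+_ eq) (ℤ.pos-* q (suc k)))))

mkℚᵘ-≤ : ∀ {p q k l} → p * suc l ≤ q * suc k → mkℚᵘ (ℤ.+ p) k ℚᵘ.≤ mkℚᵘ (ℤ.+ q) l
mkℚᵘ-≤ {p} {q} {k} {l} le =
  *≤* (subst₂ ℤ._≤_ (ℤ.pos-* p (suc l)) (ℤ.pos-* q (suc k)) (ℤ.+≤+ le))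

mkℚᵘ-+ : ∀ p q k → mkℚᵘ (ℤ.+ p) k ℚᵘ.+ mkℚᵘ (ℤ.+ q) k ≃ mkℚᵘ (ℤ.+ (p + q)) k
mkℚᵘ-+ p q k = *≡* (begin
  (ℤ.+ p ℤ.* ℤ.+ s ℤ.+ ℤ.+ q ℤ.* ℤ.+ s) ℤ.* ℤ.+ s ≡⟨ distrib (ℤ.+ p) (ℤ.+ q) (ℤ.+ s) ⟩
  (ℤ.+ p ℤ.+ ℤ.+ q) ℤ.* (ℤ.+ s ℤ.* ℤ.+ s)        ≡⟨ cong₂ ℤ._*_ (ℤ.pos-+ p q) (ℤ.pos-* s s) ⟨
  ℤ.+ (p + q) ℤ.* ℤ.+ (s * s)                   ∎)
  where
  open ≡-Reasoning
  s = suc k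
  distrib : ∀ p q s → (p ℤ.* s ℤ.+ q ℤ.* s) ℤ.* s ≡ (p ℤ.+ q) ℤ.* (s ℤ.* s)
  distrib = solve-∀ℤ

toℚᵘ-÷ℕ : ∀ p k → toℚᵘ (p ÷ℕ suc k) ≃ mkℚᵘ (ℤ.+ p) k
toℚᵘ-÷ℕ p k = ℚ.toℚᵘ-fromℚᵘ (mkℚᵘ (ℤ.+ p) k)

toℚᵘ-sum-map : ∀ {A : Set} (f : A → ℚ) (g : A → ℕ) k xs →
  (∀ x → toℚᵘ (f x) ≃ mkℚᵘ (ℤ.+ g x) k) →
  toℚᵘ (foldr ℚ._+_ 0ℚ (map f xs)) ≃ mkℚᵘ (ℤ.+ sum (map g xs)) k
toℚᵘ-sum-map f g k []       f≃g = *≡* refl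
toℚᵘ-sum-map f g k (x ∷ xs) f≃g = begin
  toℚᵘ (f x ℚ.+ foldr ℚ._+_ 0ℚ (map f xs))
    ≈⟨ ℚ.toℚᵘ-homo-+ (f x) _ ⟩
  toℚᵘ (f x) ℚᵘ.+ toℚᵘ (foldr ℚ._+_ 0ℚ (map f xs))
    ≈⟨ ℚᵘ.+-cong (f≃g x) (toℚᵘ-sum-map f g k xs f≃g) ⟩
  mkℚᵘ (ℤ.+ g x) k ℚᵘ.+ mkℚᵘ (ℤ.+ sum (map g xs)) k
    ≈⟨ mkℚᵘ-+ (g x) _ k ⟩
  mkℚᵘ (ℤ.+ (g x + sum (map g xs))) k ∎
  where open ℚᵘ.≃-Reasoning

toℚᵘ-∣fromℕ-÷ℕ∣ : ∀ x E k →
  toℚᵘ (ℚ.∣ fromℕ x ℚ.- E ÷ℕ suc k ∣) ≃ mkℚᵘ (ℤ.+ ℤ.∣ x * suc k ⊖ E ∣) k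
toℚᵘ-∣fromℕ-÷ℕ∣ x E k = begin
  toℚᵘ (ℚ.∣ fromℕ x ℚ.- E ÷ℕ suc k ∣)
    ≈⟨ ℚ.toℚᵘ-homo-∣-∣ _ ⟩
  ℚᵘ.∣ toℚᵘ (fromℕ x ℚ.- E ÷ℕ suc k) ∣
    ≈⟨ ℚᵘ.∣-∣-cong (ℚᵘ.≃-trans (ℚ.toℚᵘ-homo-+ (fromℕ x) _) (ℚᵘ.+-cong (toℚᵘ-÷ℕ x 0)
         (ℚᵘ.≃-trans (ℚ.toℚᵘ-homo‿- (E ÷ℕ suc k)) (ℚᵘ.-‿cong (toℚᵘ-÷ℕ E k))))) ⟩
  ℚᵘ.∣ mkℚᵘ (ℤ.+ x) 0 ℚᵘ.- mkℚᵘ (ℤ.+ E) k ∣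
    ≈⟨ *≡* (cong₂ (λ z d → ℤ.+ ℤ.∣ z ∣ ℤ.* ℤ.+ suc d) numerator (sym (+-identityʳ k))) ⟩
  mkℚᵘ (ℤ.+ ℤ.∣ x * suc k ⊖ E ∣) k ∎
  where
  open ℚᵘ.≃-Reasoning
  numerator : ℤ.+ x ℤ.* ℤ.+ suc k ℤ.+ ℤ.- ℤ.+ E ℤ.* ℤ.+ 1 ≡ x * suc k ⊖ E
  numerator = trans (cong₂ ℤ._+_ (sym (ℤ.pos-* x (suc k))) (ℤ.*-identityʳ (ℤ.- ℤ.+ E))) (ℤ.m-n≡m⊖n (x * suc k) E)

∣m+n⊖m∣≡n : ∀ m n → ℤ.∣ m + n ⊖ m ∣ ≡ n
∣m+n⊖m∣≡n m n rewrite ℤ.⊖-≥ (m≤m+n m n) = m+n∸m≡n m n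

∣m⊖m+n∣≡n : ∀ m n → ℤ.∣ m ⊖ (m + n) ∣ ≡ n
∣m⊖m+n∣≡n m n = trans (ℤ.∣m⊖n∣≡∣n⊖m∣ m (m + n)) (∣m+n⊖m∣≡n m n)

module BidegreedIndices {k} (G : Graph (suc k)) {Δ δ} (δ<Δ : δ < Δ)
                        (deg-cases : ∀ i → deg G i ≡ Δ ⊎ deg G i ≡ δ) where

  open DegreeCount G δ<Δ deg-cases
  open Equivalence

  n a b D : ℕ
  n = suc k
  a = countDeg G Δ
  b = countDeg G δ
  D = Δ ∸ δ

  private
    δ+D≡Δ : δ + D ≡ Δ
    δ+D≡Δ = m+[n∸m]≡n (<⇒≤ δ<Δ)

    instance
      D-nonZero : NonZero D
      D-nonZero = >-nonZero (m<n⇒0<n∸m δ<Δ)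

  Δn≡2m+N_δD : Δ * n ≡ 2 * edges G + b * D
  Δn≡2m+N_δD = begin
    Δ * n                         ≡⟨ cong₂ _*_ (sym δ+D≡Δ) (sym N_Δ+N_δ≡n) ⟩
    (δ + D) * (a + b)             ≡⟨ expand a b δ D ⟩
    a * (δ + D) + b * δ + b * D   ≡⟨ cong (λ Δ → a * Δ + b * δ + b * D) δ+D≡Δ ⟩
    a * Δ + b * δ + b * D         ≡⟨ cong (_+ b * D) (sym 2m≡N_ΔΔ+N_δδ) ⟩
    2 * edges G + b * D           ∎
    where
    open ≡-Reasoning
    expand : ∀ a b δ D → (δ + D) * (a + b) ≡ a * (δ + D) + b * δ + b * D
    expand = solve-∀

  δn+N_ΔD≡2m : δ * n + a * D ≡ 2 * edges G
  δn+N_ΔD≡2m = begin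
    δ * n + a * D                 ≡⟨ cong (λ n → δ * n + a * D) (sym N_Δ+N_δ≡n) ⟩
    δ * (a + b) + a * D           ≡⟨ expand a b δ D ⟩
    a * (δ + D) + b * δ           ≡⟨ cong (λ Δ → a * Δ + b * δ) δ+D≡Δ ⟩
    a * Δ + b * δ                 ≡⟨ 2m≡N_ΔΔ+N_δδ ⟨
    2 * edges G                   ∎
    where
    open ≡-Reasoning
    expand : ∀ a b δ D → δ * (a + b) + a * D ≡ a * (δ + D) + b * δ
    expand = solve-∀

  S≃ : toℚᵘ (S G) ≃ mkℚᵘ (ℤ.+ (2 * a * b * D)) k
  S≃ = ℚᵘ.≃-trans
    (toℚᵘ-sum-map _ distance k (allFin n) (λ i → toℚᵘ-∣fromℕ-÷ℕ∣ (deg G i) (2 * edges G) k))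
    (ℚᵘ.≃-reflexive (cong (λ x → mkℚᵘ (ℤ.+ x) k) (trans sum-distance (collect a b D))))
    where
    open ≡-Reasoning
    distance : Fin n → ℕ
    distance i = ℤ.∣ deg G i * n ⊖ 2 * edges G ∣
    distance-Δ : ∀ i → deg G i ≡ Δ → distance i ≡ b * D
    distance-Δ i d = begin
      ℤ.∣ deg G i * n ⊖ 2 * edges G ∣           ≡⟨ cong (λ x → ℤ.∣ x * n ⊖ 2 * edges G ∣) d ⟩
      ℤ.∣ Δ * n ⊖ 2 * edges G ∣                 ≡⟨ cong (λ x → ℤ.∣ x ⊖ 2 * edges G ∣) Δn≡2m+N_δD ⟩
      ℤ.∣ 2 * edges G + b * D ⊖ 2 * edges G ∣   ≡⟨ ∣m+n⊖m∣≡n (2 * edges G) (b * D) ⟩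
      b * D                                     ∎
    distance-δ : ∀ i → deg G i ≡ δ → distance i ≡ a * D
    distance-δ i d = begin
      ℤ.∣ deg G i * n ⊖ 2 * edges G ∣           ≡⟨ cong (λ x → ℤ.∣ x * n ⊖ 2 * edges G ∣) d ⟩
      ℤ.∣ δ * n ⊖ 2 * edges G ∣                 ≡⟨ cong (λ x → ℤ.∣ δ * n ⊖ x ∣) δn+N_ΔD≡2m ⟨
      ℤ.∣ δ * n ⊖ (δ * n + a * D) ∣             ≡⟨ ∣m⊖m+n∣≡n (δ * n) (a * D) ⟩
      a * D                                     ∎
    sum-distance : sum (map distance (allFin n)) ≡ a * (b * D) + b * (a * D)
    sum-distance = sum-map-by-degree distance distance-Δ distance-δ
    collect : ∀ a b D → a * (b * D) + b * (a * D) ≡ 2 * a * b * D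
    collect = solve-∀

  IRD≃ : toℚᵘ (IRD G Δ δ) ≃ mkℚᵘ (ℤ.+ (2 * a * b * D)) k
  IRD≃ = subst (λ d → toℚᵘ ((2 * a * b * D) ÷ℕ d) ≃ mkℚᵘ (ℤ.+ (2 * a * b * D)) k)
               (sym (trans (+-comm b a) N_Δ+N_δ≡n)) (toℚᵘ-÷ℕ _ k)

  IRR≃ : toℚᵘ (IRR G Δ δ) ≃ mkℚᵘ (ℤ.+ (n * D)) 1
  IRR≃ = toℚᵘ-÷ℕ (n * D) 1

  -- IRD ≤ IRR and IRD ≡ IRR cross-multiplied: 2abD · 2 versus nD · n
  private
    IRD-numerator : 2 * a * b * D * 2 ≡ 4 * (a * b) * D
    IRD-numerator = rearrange a b D
      where
      rearrange : ∀ a b D → 2 * a * b * D * 2 ≡ 4 * (a * b) * D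
      rearrange = solve-∀

    IRR-numerator : n * D * n ≡ (a + b) * (a + b) * D
    IRR-numerator = subst (λ m → m * D * m ≡ (a + b) * (a + b) * D) N_Δ+N_δ≡n (rearrange (a + b) D)
      where
      rearrange : ∀ n D → n * D * n ≡ n * n * D
      rearrange = solve-∀

  S≡IRD : S G ≡ IRD G Δ δ
  S≡IRD = ℚ.toℚᵘ-injective (ℚᵘ.≃-trans S≃ (ℚᵘ.≃-sym IRD≃))

  IRD≤IRR : IRD G Δ δ ℚ.≤ IRR G Δ δ
  IRD≤IRR = ℚ.toℚᵘ-cancel-≤
    (ℚᵘ.≤-respˡ-≃ (ℚᵘ.≃-sym IRD≃) (ℚᵘ.≤-respʳ-≃ (ℚᵘ.≃-sym IRR≃) (mkℚᵘ-≤
      (subst₂ _≤_ (sym IRD-numerator) (sym IRR-numerator) (*-monoˡ-≤ D (4mn≤[m+n]² a b))))))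

  IRD≡IRR⇔N_Δ≡N_δ : IRD G Δ δ ≡ IRR G Δ δ ⇔ a ≡ b
  IRD≡IRR⇔N_Δ≡N_δ = mk⇔
    (λ eq → to 4mn≡[m+n]²⇔m≡n (*-cancelʳ-≡ _ _ D (begin
      4 * (a * b) * D      ≡⟨ IRD-numerator ⟨
      2 * a * b * D * 2    ≡⟨ to mkℚᵘ-≃⇔ (ℚᵘ.≃-trans (ℚᵘ.≃-sym IRD≃) (ℚᵘ.≃-trans (ℚ.toℚᵘ-cong eq) IRR≃)) ⟩
      n * D * n            ≡⟨ IRR-numerator ⟩
      (a + b) * (a + b) * D ∎)))
    (λ a≡b → ℚ.toℚᵘ-injective (ℚᵘ.≃-trans IRD≃ (ℚᵘ.≃-trans (from mkℚᵘ-≃⇔ (begin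
      2 * a * b * D * 2    ≡⟨ IRD-numerator ⟩
      4 * (a * b) * D      ≡⟨ cong (_* D) (from 4mn≡[m+n]²⇔m≡n a≡b) ⟩
      (a + b) * (a + b) * D ≡⟨ IRR-numerator ⟨
      n * D * n            ∎)) (ℚᵘ.≃-sym IRR≃))))
    where open ≡-Reasoning

  N_Δ≡N_δ⇔balanced : 3 ≤ n → a ≡ b ⇔ (4 ≤ n × 2 ∣ n × 2 * a ≡ n × 2 * b ≡ n)
  N_Δ≡N_δ⇔balanced 3≤n = mk⇔ a≡b⇒balanced λ (_ , _ , 2a≡n , 2b≡n) → *-cancelˡ-≡ a b 2 (trans 2a≡n (sym 2b≡n))
    where
    a≡b⇒balanced : a ≡ b → 4 ≤ n × 2 ∣ n × 2 * a ≡ n × 2 * b ≡ n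
    a≡b⇒balanced a≡b = subst (4 ≤_) 2a≡n (3≤2m⇒4≤2m a (subst (3 ≤_) (sym 2a≡n) 3≤n))
                 , divides a (trans (sym 2a≡n) (*-comm 2 a)) , 2a≡n , trans (cong (2 *_) (sym a≡b)) 2a≡n
      where
      2a≡n : 2 * a ≡ n
      2a≡n = trans (cong (a +_) (trans (+-identityʳ a) a≡b)) N_Δ+N_δ≡n

proposition8 : (n : ℕ) (G : Graph n) (Δ δ : ℕ) → Connected G → Bidegreed G Δ δ →
    (S G ≡ IRD G Δ δ) × (IRD G Δ δ ℚ.≤ IRR G Δ δ)
    × ((IRD G Δ δ ≡ IRR G Δ δ) ⇔ ((4 ≤ n) × (2 ∣ n) × (2 * countDeg G Δ ≡ n) × (2 * countDeg G δ ≡ n)))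
proposition8 zero    G Δ δ conn (_ , _ , (() , _) , _)
proposition8 (suc k) G Δ δ conn bd@(δ<Δ , deg-cases , _) =
  S≡IRD , IRD≤IRR ,
  ⇔-trans IRD≡IRR⇔N_Δ≡N_δ (N_Δ≡N_δ⇔balanced (connected-bidegreed⇒3≤n G conn bd))
  where
  open BidegreedIndices G δ<Δ deg-cases
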